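{- Let $\mathbf{b}=(b_0,b_1,b_2,\ldots)$ be the increasing sequence of all $n\in\mathbb{N}$ such that $\binom{2n}{n}\equiv -1\pmod 3$. Let $\mathbf{t}=(t_0,t_1,\ldots)$ be the Thue–Morse sequence, i.e. $t_i$ is the remainder on division by $2$ of the number of ones in the binary expansion of $i$. Then $b_i\equiv 1-t_i\pmod 3$ for all $i\in\mathbb{N}$.
   Context: Equivalently, the Thue–Morse sequence is defined by $t_0=0$, $t_{2i}=t_i$, $t_{2i+1}=1-t_i$. -}

module Defs where

open import Data.Nat using (ℕ; zero; suc; _+_; _*_; _∸_; _<_; _%_; _/_)
open import Data.Nat.Combinatorics using (_C_)
open import Relation.Binary.PropositionalEquality using (_≡_)

-- number of ones in the binary expansion, computed with fuel;
-- fuel n suffices for n since each step halves n (and 0 has no ones)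
onesFuel : ℕ → ℕ → ℕ
onesFuel zero    n = 0
onesFuel (suc f) n = n % 2 + onesFuel f (n / 2)

binaryOnes : ℕ → ℕ
binaryOnes n = onesFuel n n

thueMorse : ℕ → ℕ
thueMorse i = binaryOnes i % 2

IsB : ℕ → Set
IsB n = ((2 * n) C n) % 3 ≡ 2

IsIncreasingEnumeration : (ℕ → Set) → (ℕ → ℕ) → Set
IsIncreasingEnumeration P b =
  (∀ i → b i < b (suc i)) × (∀ n → P n ⇔ (∃ λ i → b i ≡ n))
  where
    open import Data.Product using (_×_; ∃)
    open import Function.Bundles using (_⇔_)

-- Lucas's theorem gives C(2n,n) ≡ ∏ C(2d,d) (mod 3) over the base-3 digits d of n, and
-- C(0,0), C(2,1), C(4,2) ≡ 1, −1, 0.  So C(2n,n) ≡ −1 exactly when n has only the digits 0 and 1,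
-- i.e. n is the binary expansion of some m read in base 3, and an odd number of them are 1, i.e.
-- t(m) = 1.  Reading in base 3 is increasing, and the m with t(m) = 1 are enumerated in order
-- by i ↦ 2i + 1 − t(i), since exactly one of 2i, 2i + 1 has t = 1.  Hence
-- b(i) = 3·(i read in base 3) + 1 − t(i).
module Submission where

open import Defs
open import Data.Nat
  using (ℕ; zero; suc; _+_; _*_; _∸_; _%_; _/_; _≤_; _<_; _≤′_; ≤′-refl; ≤′-step; z≤n; s≤s; z<s; s<s; NonZero; NonTrivial; nonTrivial⇒nonZero; nonTrivial⇒n>1)
open import Data.Nat.Properties
  using (≤-refl; ≤-trans; ≤-antisym; ≤-reflexive; ≤-pred; <⇒≤; <⇒≱; ≰⇒>; ≤⇒≤′; n<1+n; n≤1+n; m≤n+m; m∸n≤m; +-monoˡ-≤; *-monoˡ-≤; *-identityʳ; +-identityʳ; module ≤-Reasoning)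
open import Data.Nat.DivMod
  using (DivMod; _divMod_; _mod_; m≡m%n+[m/n]*n; m%n<n; m/n<m; [m+kn]%n≡m%n; m<n⇒m%n≡m; m<n⇒m/n≡0; +-distrib-/; m*n/n≡m; m*n%n≡0)
open import Data.Nat.Induction using (<-rec)
open import Data.Nat.Combinatorics using (_C_; nCk+nC[k+1]≡[n+1]C[k+1])
open import Data.Nat.Tactic.RingSolver using (solve-∀)
open import Data.Fin using (Fin; toℕ)
open import Data.Fin.Patterns using (0F; 1F; 2F)
open import Data.Product using (∃; _×_; _,_)
open import Data.Sum using (_⊎_; inj₁; inj₂)
open import Data.Empty using (⊥-elim)
open import Function using (_∘_)
open import Function.Bundles using (_⇔_; mk⇔; Equivalence)
open import Relation.Binary.PropositionalEquality
  using (_≡_; _≢_; refl; sym; trans; cong; cong₂; subst; module ≡-Reasoning)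

data ℤ₃ : Set where
  0₃ 1₃ -1₃ : ℤ₃

infixl 6 _+₃_
infixl 7 _*₃_
infix  8 -_
infixl 8 _^₃_

-_ : ℤ₃ → ℤ₃
- 0₃  = 0₃
- 1₃  = -1₃
- -1₃ = 1₃

_+₃_ : ℤ₃ → ℤ₃ → ℤ₃
0₃  +₃ y   = y
1₃  +₃ 0₃  = 1₃
1₃  +₃ 1₃  = -1₃
1₃  +₃ -1₃ = 0₃
-1₃ +₃ 0₃  = -1₃
-1₃ +₃ 1₃  = 0₃
-1₃ +₃ -1₃ = 1₃

-- Multiplication is by cases on the right factor, so that products by the closed binomials
-- binom₃ r d in lucas₃ compute.
_*₃_ : ℤ₃ → ℤ₃ → ℤ₃
x *₃ 0₃  = 0₃
x *₃ 1₃  = x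
x *₃ -1₃ = - x

_^₃_ : ℤ₃ → ℕ → ℤ₃
x ^₃ zero  = 1₃
x ^₃ suc n = x ^₃ n *₃ x

+₃-identityʳ : ∀ x → x +₃ 0₃ ≡ x
+₃-identityʳ 0₃  = refl
+₃-identityʳ 1₃  = refl
+₃-identityʳ -1₃ = refl

+₃-assoc : ∀ x y z → (x +₃ y) +₃ z ≡ x +₃ (y +₃ z)
+₃-assoc 0₃  y   z   = refl
+₃-assoc 1₃  0₃  z   = refl
+₃-assoc -1₃ 0₃  z   = refl
+₃-assoc 1₃  1₃  0₃  = refl
+₃-assoc 1₃  1₃  1₃  = refl
+₃-assoc 1₃  1₃  -1₃ = refl
+₃-assoc 1₃  -1₃ 0₃  = refl
+₃-assoc 1₃  -1₃ 1₃  = refl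
+₃-assoc 1₃  -1₃ -1₃ = refl
+₃-assoc -1₃ 1₃  0₃  = refl
+₃-assoc -1₃ 1₃  1₃  = refl
+₃-assoc -1₃ 1₃  -1₃ = refl
+₃-assoc -1₃ -1₃ 0₃  = refl
+₃-assoc -1₃ -1₃ 1₃  = refl
+₃-assoc -1₃ -1₃ -1₃ = refl

+₃-inverseˡ : ∀ x → - x +₃ x ≡ 0₃
+₃-inverseˡ 0₃  = refl
+₃-inverseˡ 1₃  = refl
+₃-inverseˡ -1₃ = refl

+₃-inverseʳ : ∀ x → x +₃ - x ≡ 0₃
+₃-inverseʳ 0₃  = refl
+₃-inverseʳ 1₃  = refl
+₃-inverseʳ -1₃ = refl

x+₃x≡-x : ∀ x → x +₃ x ≡ - x
x+₃x≡-x 0₃  = refl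
x+₃x≡-x 1₃  = refl
x+₃x≡-x -1₃ = refl

-‿involutive : ∀ x → - - x ≡ x
-‿involutive 0₃  = refl
-‿involutive 1₃  = refl
-‿involutive -1₃ = refl

-1₃^n≡-1₃^[n%2] : ∀ n → -1₃ ^₃ n ≡ -1₃ ^₃ (n % 2)
-1₃^n≡-1₃^[n%2] 0             = refl
-1₃^n≡-1₃^[n%2] 1             = refl
-1₃^n≡-1₃^[n%2] (suc (suc n)) = trans (-‿involutive (-1₃ ^₃ n)) (-1₃^n≡-1₃^[n%2] n)

-1₃^b≡-1₃⇒b≡1 : ∀ {b} → b ≡ 0 ⊎ b ≡ 1 → -1₃ ^₃ b ≡ -1₃ → b ≡ 1
-1₃^b≡-1₃⇒b≡1 (inj₁ refl) ()
-1₃^b≡-1₃⇒b≡1 (inj₂ b≡1) _ = b≡1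

toℤ₃ : ℕ → ℤ₃
toℤ₃ zero    = 0₃
toℤ₃ (suc n) = 1₃ +₃ toℤ₃ n

toℤ₃-+ : ∀ m n → toℤ₃ (m + n) ≡ toℤ₃ m +₃ toℤ₃ n
toℤ₃-+ zero    n = refl
toℤ₃-+ (suc m) n = trans (cong (1₃ +₃_) (toℤ₃-+ m n)) (sym (+₃-assoc 1₃ (toℤ₃ m) (toℤ₃ n)))

toℤ₃[n*3]≡0₃ : ∀ n → toℤ₃ (n * 3) ≡ 0₃
toℤ₃[n*3]≡0₃ zero    = refl
toℤ₃[n*3]≡0₃ (suc n) = cong (λ x → 1₃ +₃ (1₃ +₃ (1₃ +₃ x))) (toℤ₃[n*3]≡0₃ n)

toℤ₃[n%3]≡toℤ₃[n] : ∀ n → toℤ₃ (n % 3) ≡ toℤ₃ n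
toℤ₃[n%3]≡toℤ₃[n] n = sym (begin
  toℤ₃ n                          ≡⟨ cong toℤ₃ (m≡m%n+[m/n]*n n 3) ⟩
  toℤ₃ (n % 3 + n / 3 * 3)        ≡⟨ toℤ₃-+ (n % 3) (n / 3 * 3) ⟩
  toℤ₃ (n % 3) +₃ toℤ₃ (n / 3 * 3) ≡⟨ cong (toℤ₃ (n % 3) +₃_) (toℤ₃[n*3]≡0₃ (n / 3)) ⟩
  toℤ₃ (n % 3) +₃ 0₃              ≡⟨ +₃-identityʳ (toℤ₃ (n % 3)) ⟩
  toℤ₃ (n % 3)                    ∎)
  where open ≡-Reasoning

%3≡2⇔toℤ₃≡-1₃ : ∀ n → n % 3 ≡ 2 ⇔ toℤ₃ n ≡ -1₃
%3≡2⇔toℤ₃≡-1₃ n = mk⇔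
  (λ n%3≡2 → trans (sym (toℤ₃[n%3]≡toℤ₃[n] n)) (cong toℤ₃ n%3≡2))
  (λ toℤ₃n≡-1 → residue (n % 3) (m%n<n n 3) (trans (toℤ₃[n%3]≡toℤ₃[n] n) toℤ₃n≡-1))
  where
  residue : ∀ r → r < 3 → toℤ₃ r ≡ -1₃ → r ≡ 2
  residue 0 _ ()
  residue 1 _ ()
  residue 2 _ _ = refl
  residue (suc (suc (suc _))) (s≤s (s≤s (s≤s ()))) _

binom₃ : ℕ → ℕ → ℤ₃
binom₃ n       zero    = 1₃
binom₃ zero    (suc k) = 0₃
binom₃ (suc n) (suc k) = binom₃ n k +₃ binom₃ n (suc k)

toℤ₃[nCk]≡binom₃ : ∀ n k → toℤ₃ (n C k) ≡ binom₃ n k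
toℤ₃[nCk]≡binom₃ n       zero    = refl
toℤ₃[nCk]≡binom₃ zero    (suc k) = refl
toℤ₃[nCk]≡binom₃ (suc n) (suc k) = begin
  toℤ₃ (suc n C suc k)                  ≡⟨ cong toℤ₃ (nCk+nC[k+1]≡[n+1]C[k+1] n k) ⟨
  toℤ₃ (n C k + n C suc k)              ≡⟨ toℤ₃-+ (n C k) (n C suc k) ⟩
  toℤ₃ (n C k) +₃ toℤ₃ (n C suc k)      ≡⟨ cong₂ _+₃_ (toℤ₃[nCk]≡binom₃ n k) (toℤ₃[nCk]≡binom₃ n (suc k)) ⟩
  binom₃ n k +₃ binom₃ n (suc k)        ∎
  where open ≡-Reasoning

-- Lucas's theorem for p = 3, one base-3 digit at a time, split by the upper digit.  Each case is
-- one step of Pascal's rule, in which the lower digit may borrow from the next digit.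
lucas₃-0 : ∀ (d : Fin 3) a b → binom₃ (a * 3) (toℕ d + b * 3) ≡ binom₃ a b *₃ binom₃ 0 (toℕ d)
lucas₃-1 : ∀ (d : Fin 3) a b → binom₃ (1 + a * 3) (toℕ d + b * 3) ≡ binom₃ a b *₃ binom₃ 1 (toℕ d)
lucas₃-2 : ∀ (d : Fin 3) a b → binom₃ (2 + a * 3) (toℕ d + b * 3) ≡ binom₃ a b *₃ binom₃ 2 (toℕ d)

lucas₃-0 0F zero    zero    = refl
lucas₃-0 1F zero    zero    = refl
lucas₃-0 2F zero    zero    = refl
lucas₃-0 0F zero    (suc b) = refl
lucas₃-0 1F zero    (suc b) = refl
lucas₃-0 2F zero    (suc b) = refl
lucas₃-0 0F (suc a) zero    = refl
lucas₃-0 0F (suc a) (suc b) = cong₂ _+₃_ (lucas₃-2 2F a b) (lucas₃-2 0F a (suc b))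
lucas₃-0 1F (suc a) b       =
  trans (cong₂ _+₃_ (lucas₃-2 0F a b) (lucas₃-2 1F a b)) (+₃-inverseʳ (binom₃ a b))
lucas₃-0 2F (suc a) b       =
  trans (cong₂ _+₃_ (lucas₃-2 1F a b) (lucas₃-2 2F a b)) (+₃-inverseˡ (binom₃ a b))

lucas₃-1 0F a zero    = refl
lucas₃-1 0F a (suc b) = cong₂ _+₃_ (lucas₃-0 2F a b) (lucas₃-0 0F a (suc b))
lucas₃-1 1F a b       =
  trans (cong₂ _+₃_ (lucas₃-0 0F a b) (lucas₃-0 1F a b)) (+₃-identityʳ (binom₃ a b))
lucas₃-1 2F a b       = cong₂ _+₃_ (lucas₃-0 1F a b) (lucas₃-0 2F a b)

lucas₃-2 0F a zero    = refl
lucas₃-2 0F a (suc b) = cong₂ _+₃_ (lucas₃-1 2F a b) (lucas₃-1 0F a (suc b))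
lucas₃-2 1F a b       =
  trans (cong₂ _+₃_ (lucas₃-1 0F a b) (lucas₃-1 1F a b)) (x+₃x≡-x (binom₃ a b))
lucas₃-2 2F a b       =
  trans (cong₂ _+₃_ (lucas₃-1 1F a b) (lucas₃-1 2F a b)) (+₃-identityʳ (binom₃ a b))

central₃ : ℕ → ℤ₃
central₃ n = binom₃ (2 * n) n

central₃-digit : ∀ (d : Fin 3) a → central₃ (toℕ d + a * 3) ≡ central₃ a *₃ central₃ (toℕ d)
central₃-digit 0F a =
  trans (cong (λ m → binom₃ m (a * 3)) (twice a)) (lucas₃-0 0F (2 * a) a)
  where
  twice : ∀ a → 2 * (a * 3) ≡ (2 * a) * 3
  twice = solve-∀
central₃-digit 1F a =
  trans (cong (λ m → binom₃ m (1 + a * 3)) (twice a)) (lucas₃-2 1F (2 * a) a)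
  where
  twice : ∀ a → 2 * (1 + a * 3) ≡ 2 + (2 * a) * 3
  twice = solve-∀
central₃-digit 2F a =
  trans (cong (λ m → binom₃ m (2 + a * 3)) (twice a)) (lucas₃-1 2F (1 + 2 * a) a)
  where
  twice : ∀ a → 2 * (2 + a * 3) ≡ 1 + (1 + 2 * a) * 3
  twice = solve-∀

[r+q*n]%n≡r : ∀ {r n} .{{_ : NonZero n}} q → r < n → (r + q * n) % n ≡ r
[r+q*n]%n≡r {r} {n} q r<n = trans ([m+kn]%n≡m%n r q n) (m<n⇒m%n≡m r<n)

[r+q*n]/n≡q : ∀ {r n} .{{_ : NonZero n}} q → r < n → (r + q * n) / n ≡ q
[r+q*n]/n≡q {r} {n} q r<n = trans (+-distrib-/ r (q * n) digitsFit) (cong₂ _+_ (m<n⇒m/n≡0 r<n) (m*n/n≡m q n))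
  where
  open ≤-Reasoning
  digitsFit : r % n + q * n % n < n
  digitsFit = begin-strict
    r % n + q * n % n  ≡⟨ cong₂ _+_ (m<n⇒m%n≡m r<n) (m*n%n≡0 q n) ⟩
    r + 0              ≡⟨ +-identityʳ r ⟩
    r                  <⟨ r<n ⟩
    n                  ∎

[1+n]/2≤n : ∀ n → suc n / 2 ≤ n
[1+n]/2≤n n = ≤-pred (m/n<m (suc n) 2 (s<s z<s))

n%2≡0⊎n%2≡1 : ∀ n → n % 2 ≡ 0 ⊎ n % 2 ≡ 1
n%2≡0⊎n%2≡1 0             = inj₁ refl
n%2≡0⊎n%2≡1 1             = inj₂ refl
n%2≡0⊎n%2≡1 (suc (suc n)) = n%2≡0⊎n%2≡1 n

[1+n]%2≡1∸n%2 : ∀ n → suc n % 2 ≡ 1 ∸ n % 2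
[1+n]%2≡1∸n%2 0             = refl
[1+n]%2≡1∸n%2 1             = refl
[1+n]%2≡1∸n%2 (suc (suc n)) = [1+n]%2≡1∸n%2 n

digit-induction : ∀ {ℓ} (P : ℕ → Set ℓ) k .{{_ : NonTrivial k}} → P 0 →
                  (∀ (r : Fin k) q → P q → P (toℕ r + q * k)) → ∀ n → P n
digit-induction P k {{k>1}} p₀ step = <-rec P go
  where
  instance _ = nonTrivial⇒nonZero k {{k>1}}
  go : ∀ n → (∀ {m} → m < n → P m) → P n
  go zero    _   = p₀
  go (suc n) rec = subst P (sym (DivMod.property (suc n divMod k)))
    (step (suc n mod k) (suc n / k) (rec (m/n<m (suc n) k (nonTrivial⇒n>1 k {{k>1}}))))

StrictlyIncreasing : (ℕ → ℕ) → Set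
StrictlyIncreasing f = ∀ i → f i < f (suc i)

strictlyIncreasing⇒mono-≤ : ∀ {f} → StrictlyIncreasing f → ∀ {i j} → i ≤ j → f i ≤ f j
strictlyIncreasing⇒mono-≤ {f} f↑ i≤j = go (≤⇒≤′ i≤j)
  where
  go : ∀ {i j} → i ≤′ j → f i ≤ f j
  go ≤′-refl        = ≤-refl
  go (≤′-step i≤′j) = ≤-trans (go i≤′j) (<⇒≤ (f↑ _))

strictlyIncreasing⇒cancel-< : ∀ {f} → StrictlyIncreasing f → ∀ {i j} → f i < f j → i < j
strictlyIncreasing⇒cancel-< f↑ fi<fj = ≰⇒> (<⇒≱ fi<fj ∘ strictlyIncreasing⇒mono-≤ f↑)

strictlyIncreasing-∘ : ∀ {f g} → StrictlyIncreasing f → StrictlyIncreasing g → StrictlyIncreasing (f ∘ g)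
strictlyIncreasing-∘ {f} {g} f↑ g↑ i = begin-strict
  f (g i)        <⟨ f↑ (g i) ⟩
  f (suc (g i))  ≤⟨ strictlyIncreasing⇒mono-≤ f↑ (g↑ i) ⟩
  f (g (suc i))  ∎
  where open ≤-Reasoning

enumeration-≤ : ∀ {f g} → StrictlyIncreasing f → StrictlyIncreasing g →
                (∀ j → ∃ λ k → f k ≡ g j) → ∀ i → f i ≤ g i
enumeration-≤ {f} {g} f↑ g↑ g⊆f zero =
  let k , fk≡g0 = g⊆f 0 in ≤-trans (strictlyIncreasing⇒mono-≤ f↑ z≤n) (≤-reflexive fk≡g0)
enumeration-≤ {f} {g} f↑ g↑ g⊆f (suc i) =
  let k , fk≡g[1+i] = g⊆f (suc i)
      i<k = strictlyIncreasing⇒cancel-< f↑ (begin-strict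
              f i        ≤⟨ enumeration-≤ f↑ g↑ g⊆f i ⟩
              g i        <⟨ g↑ i ⟩
              g (suc i)  ≡⟨ fk≡g[1+i] ⟨
              f k        ∎)
  in ≤-trans (strictlyIncreasing⇒mono-≤ f↑ i<k) (≤-reflexive fk≡g[1+i])
  where open ≤-Reasoning

increasingEnumeration-unique : ∀ {P f g} → IsIncreasingEnumeration P f → IsIncreasingEnumeration P g →
                               ∀ i → f i ≡ g i
increasingEnumeration-unique {P} {f} {g} (f↑ , P⇔ran-f) (g↑ , P⇔ran-g) i =
  ≤-antisym (enumeration-≤ f↑ g↑ (ran⊆ran g f P⇔ran-g P⇔ran-f) i)
            (enumeration-≤ g↑ f↑ (ran⊆ran f g P⇔ran-f P⇔ran-g) i)
  where
  ran⊆ran : ∀ h h′ → (∀ n → P n ⇔ ∃ λ i → h i ≡ n) → (∀ n → P n ⇔ ∃ λ i → h′ i ≡ n) →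
            ∀ j → ∃ λ k → h′ k ≡ h j
  ran⊆ran h h′ P⇔ran-h P⇔ran-h′ j =
    Equivalence.to (P⇔ran-h′ (h j)) (Equivalence.from (P⇔ran-h (h j)) (j , refl))

readBinaryFuel : ℕ → ℕ → ℕ → ℕ
readBinaryFuel k zero    n = 0
readBinaryFuel k (suc f) n = n % 2 + readBinaryFuel k f (n / 2) * k

readBinary : ℕ → ℕ → ℕ
readBinary k n = readBinaryFuel k n n

readBinaryFuel-0 : ∀ k f → readBinaryFuel k f 0 ≡ 0
readBinaryFuel-0 k zero    = refl
readBinaryFuel-0 k (suc f) = cong (_* k) (readBinaryFuel-0 k f)

readBinaryFuel-irrelevant : ∀ k {f g} n → n ≤ f → n ≤ g → readBinaryFuel k f n ≡ readBinaryFuel k g n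
readBinaryFuel-irrelevant k {f} {g} zero _ _ = trans (readBinaryFuel-0 k f) (sym (readBinaryFuel-0 k g))
readBinaryFuel-irrelevant k {suc f} {suc g} (suc n) (s≤s n≤f) (s≤s n≤g) =
  cong (λ x → suc n % 2 + x * k)
    (readBinaryFuel-irrelevant k (suc n / 2) (≤-trans ([1+n]/2≤n n) n≤f) (≤-trans ([1+n]/2≤n n) n≤g))

readBinary-unfold : ∀ k n → readBinary k n ≡ n % 2 + readBinary k (n / 2) * k
readBinary-unfold k zero    = refl
readBinary-unfold k (suc n) =
  cong (λ x → suc n % 2 + x * k) (readBinaryFuel-irrelevant k (suc n / 2) ([1+n]/2≤n n) ≤-refl)

readBinary-digit : ∀ k {r} q → r < 2 → readBinary k (r + q * 2) ≡ r + readBinary k q * k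
readBinary-digit k {r} q r<2 = trans (readBinary-unfold k (r + q * 2))
  (cong₂ (λ x y → x + readBinary k y * k) ([r+q*n]%n≡r q r<2) ([r+q*n]/n≡q q r<2))

binaryOnes≡readBinary1 : ∀ n → binaryOnes n ≡ readBinary 1 n
binaryOnes≡readBinary1 n = onesFuel≡readBinaryFuel1 n n
  where
  onesFuel≡readBinaryFuel1 : ∀ f n → onesFuel f n ≡ readBinaryFuel 1 f n
  onesFuel≡readBinaryFuel1 zero    n = refl
  onesFuel≡readBinaryFuel1 (suc f) n =
    cong (n % 2 +_) (trans (onesFuel≡readBinaryFuel1 f (n / 2)) (sym (*-identityʳ _)))

binaryOnes-digit : ∀ {r} q → r < 2 → binaryOnes (r + q * 2) ≡ r + binaryOnes q
binaryOnes-digit {r} q r<2 = begin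
  binaryOnes (r + q * 2)   ≡⟨ binaryOnes≡readBinary1 (r + q * 2) ⟩
  readBinary 1 (r + q * 2) ≡⟨ readBinary-digit 1 q r<2 ⟩
  r + readBinary 1 q * 1   ≡⟨ cong (r +_) (*-identityʳ (readBinary 1 q)) ⟩
  r + readBinary 1 q       ≡⟨ cong (r +_) (binaryOnes≡readBinary1 q) ⟨
  r + binaryOnes q         ∎
  where open ≡-Reasoning

ternary : ℕ → ℕ
ternary = readBinary 3

ternary-digit : ∀ {r} q → r < 2 → ternary (r + q * 2) ≡ r + ternary q * 3
ternary-digit = readBinary-digit 3

thueMorse-even : ∀ i → thueMorse (i * 2) ≡ thueMorse i
thueMorse-even i = cong (_% 2) (binaryOnes-digit i z<s)

thueMorse-odd : ∀ i → thueMorse (1 + i * 2) ≡ 1 ∸ thueMorse i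
thueMorse-odd i = trans (cong (_% 2) (binaryOnes-digit i (s<s z<s))) ([1+n]%2≡1∸n%2 (binaryOnes i))

ternary-increasing : StrictlyIncreasing ternary
ternary-increasing = digit-induction _ 2 z<s step
  where
  open ≤-Reasoning
  step : ∀ (r : Fin 2) q → ternary q < ternary (suc q) →
         ternary (toℕ r + q * 2) < ternary (suc (toℕ r + q * 2))
  step 0F q _ = begin-strict
    ternary (q * 2)     ≡⟨ ternary-digit q z<s ⟩
    ternary q * 3       <⟨ n<1+n _ ⟩
    1 + ternary q * 3   ≡⟨ ternary-digit q (s<s z<s) ⟨
    ternary (1 + q * 2) ∎
  step 1F q ih = begin-strict
    ternary (1 + q * 2)   ≡⟨ ternary-digit q (s<s z<s) ⟩
    1 + ternary q * 3     <⟨ s≤s (s≤s (n≤1+n _)) ⟩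
    suc (ternary q) * 3   ≤⟨ *-monoˡ-≤ 3 ih ⟩
    ternary (suc q) * 3   ≡⟨ ternary-digit (suc q) z<s ⟨
    ternary (suc q * 2)   ∎

central₃-ternary : ∀ m → central₃ (ternary m) ≡ -1₃ ^₃ thueMorse m
central₃-ternary m = trans (central₃-ternary-ones m) (-1₃^n≡-1₃^[n%2] (binaryOnes m))
  where
  open ≡-Reasoning
  step : ∀ (r : Fin 2) q → central₃ (ternary q) ≡ -1₃ ^₃ binaryOnes q →
         central₃ (ternary (toℕ r + q * 2)) ≡ -1₃ ^₃ binaryOnes (toℕ r + q * 2)
  step 0F q ih = begin
    central₃ (ternary (q * 2))    ≡⟨ cong central₃ (ternary-digit q z<s) ⟩
    central₃ (ternary q * 3)      ≡⟨ central₃-digit 0F (ternary q) ⟩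
    central₃ (ternary q)          ≡⟨ ih ⟩
    -1₃ ^₃ binaryOnes q           ≡⟨ cong (-1₃ ^₃_) (binaryOnes-digit q z<s) ⟨
    -1₃ ^₃ binaryOnes (q * 2)     ∎
  step 1F q ih = begin
    central₃ (ternary (1 + q * 2))   ≡⟨ cong central₃ (ternary-digit q (s<s z<s)) ⟩
    central₃ (1 + ternary q * 3)     ≡⟨ central₃-digit 1F (ternary q) ⟩
    - central₃ (ternary q)           ≡⟨ cong -_ ih ⟩
    -1₃ ^₃ suc (binaryOnes q)        ≡⟨ cong (-1₃ ^₃_) (binaryOnes-digit q (s<s z<s)) ⟨
    -1₃ ^₃ binaryOnes (1 + q * 2)    ∎
  central₃-ternary-ones : ∀ m → central₃ (ternary m) ≡ -1₃ ^₃ binaryOnes m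
  central₃-ternary-ones = digit-induction _ 2 refl step

central₃≢0₃⇒ternary : ∀ n → central₃ n ≢ 0₃ → ∃ λ m → ternary m ≡ n
central₃≢0₃⇒ternary = digit-induction _ 3 (λ _ → 0 , refl) step
  where
  step : ∀ (d : Fin 3) a → (central₃ a ≢ 0₃ → ∃ λ m → ternary m ≡ a) →
         central₃ (toℕ d + a * 3) ≢ 0₃ → ∃ λ m → ternary m ≡ toℕ d + a * 3
  step 0F a ih c≢0 with ih (c≢0 ∘ trans (central₃-digit 0F a))
  ... | m , tm≡a = m * 2 , trans (ternary-digit m z<s) (cong (_* 3) tm≡a)
  step 1F a ih c≢0 with ih (c≢0 ∘ trans (central₃-digit 1F a) ∘ cong -_)
  ... | m , tm≡a = 1 + m * 2 , trans (ternary-digit m (s<s z<s)) (cong (λ x → 1 + x * 3) tm≡a)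
  step 2F a ih c≢0 = ⊥-elim (c≢0 (central₃-digit 2F a))

isB⇔central₃≡-1₃ : ∀ n → IsB n ⇔ central₃ n ≡ -1₃
isB⇔central₃≡-1₃ n =
  subst (λ c → IsB n ⇔ c ≡ -1₃) (toℤ₃[nCk]≡binom₃ (2 * n) n) (%3≡2⇔toℤ₃≡-1₃ ((2 * n) C n))

thueMorse≡1⇒isB-ternary : ∀ m → thueMorse m ≡ 1 → IsB (ternary m)
thueMorse≡1⇒isB-ternary m tₘ≡1 = Equivalence.from (isB⇔central₃≡-1₃ (ternary m))
  (trans (central₃-ternary m) (cong (-1₃ ^₃_) tₘ≡1))

isB⇒ternary : ∀ n → IsB n → ∃ λ m → ternary m ≡ n × thueMorse m ≡ 1
isB⇒ternary n isB =
  let m , tm≡n = central₃≢0₃⇒ternary n (subst (_≢ 0₃) (sym c≡-1) (λ ())) in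
  m , tm≡n , -1₃^b≡-1₃⇒b≡1 (n%2≡0⊎n%2≡1 (binaryOnes m))
    (trans (sym (central₃-ternary m)) (trans (cong central₃ tm≡n) c≡-1))
  where
  c≡-1 : central₃ n ≡ -1₃
  c≡-1 = Equivalence.to (isB⇔central₃≡-1₃ n) isB

odious : ℕ → ℕ
odious i = (1 ∸ thueMorse i) + i * 2

thueMorse-odious : ∀ i → thueMorse (odious i) ≡ 1
thueMorse-odious i with n%2≡0⊎n%2≡1 (binaryOnes i)
... | inj₁ tᵢ≡0 = begin
  thueMorse (odious i)   ≡⟨ cong (λ t → thueMorse ((1 ∸ t) + i * 2)) tᵢ≡0 ⟩
  thueMorse (1 + i * 2)  ≡⟨ thueMorse-odd i ⟩
  1 ∸ thueMorse i        ≡⟨ cong (1 ∸_) tᵢ≡0 ⟩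
  1                      ∎
  where open ≡-Reasoning
... | inj₂ tᵢ≡1 = begin
  thueMorse (odious i)   ≡⟨ cong (λ t → thueMorse ((1 ∸ t) + i * 2)) tᵢ≡1 ⟩
  thueMorse (i * 2)      ≡⟨ thueMorse-even i ⟩
  thueMorse i            ≡⟨ tᵢ≡1 ⟩
  1                      ∎
  where open ≡-Reasoning

thueMorse≡1⇒lastBit : ∀ {r} q → r ≡ 0 ⊎ r ≡ 1 → thueMorse (r + q * 2) ≡ 1 → 1 ∸ thueMorse q ≡ r
thueMorse≡1⇒lastBit q (inj₁ refl) t≡1 = cong (1 ∸_) (trans (sym (thueMorse-even q)) t≡1)
thueMorse≡1⇒lastBit q (inj₂ refl) t≡1 = trans (sym (thueMorse-odd q)) t≡1

thueMorse≡1⇒odious : ∀ m → thueMorse m ≡ 1 → ∃ λ i → odious i ≡ m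
thueMorse≡1⇒odious m tₘ≡1 = m / 2 , (begin
  (1 ∸ thueMorse (m / 2)) + m / 2 * 2  ≡⟨ cong (_+ m / 2 * 2) (thueMorse≡1⇒lastBit (m / 2) (n%2≡0⊎n%2≡1 m) t≡1) ⟩
  m % 2 + m / 2 * 2                    ≡⟨ m≡m%n+[m/n]*n m 2 ⟨
  m                                    ∎)
  where
  open ≡-Reasoning
  t≡1 : thueMorse (m % 2 + m / 2 * 2) ≡ 1
  t≡1 = trans (cong thueMorse (sym (m≡m%n+[m/n]*n m 2))) tₘ≡1

odious-increasing : StrictlyIncreasing odious
odious-increasing i = begin-strict
  odious i        ≤⟨ +-monoˡ-≤ (i * 2) (m∸n≤m 1 (thueMorse i)) ⟩
  1 + i * 2       <⟨ n<1+n _ ⟩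
  suc i * 2       ≤⟨ m≤n+m (suc i * 2) (1 ∸ thueMorse (suc i)) ⟩
  odious (suc i)  ∎
  where open ≤-Reasoning

ternary-odious : ∀ i → ternary (odious i) ≡ (1 ∸ thueMorse i) + ternary i * 3
ternary-odious i = ternary-digit i (s≤s (m∸n≤m 1 (thueMorse i)))

ternary∘odious-enumerates-B : IsIncreasingEnumeration IsB (ternary ∘ odious)
ternary∘odious-enumerates-B = strictlyIncreasing-∘ ternary-increasing odious-increasing , λ n → mk⇔
  (λ isB → let m , tm≡n , tₘ≡1 = isB⇒ternary n isB
               i , oᵢ≡m        = thueMorse≡1⇒odious m tₘ≡1
           in i , trans (cong ternary oᵢ≡m) tm≡n)
  (λ { (i , t[oᵢ]≡n) → subst IsB t[oᵢ]≡n (thueMorse≡1⇒isB-ternary (odious i) (thueMorse-odious i)) })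

theorem4p6 : (b : ℕ → ℕ) → IsIncreasingEnumeration IsB b →
    ∀ i → b i % 3 ≡ (1 ∸ thueMorse i) % 3
theorem4p6 b b-enumerates-B i = begin
  b i % 3                                   ≡⟨ cong (_% 3) (increasingEnumeration-unique b-enumerates-B ternary∘odious-enumerates-B i) ⟩
  ternary (odious i) % 3                    ≡⟨ cong (_% 3) (ternary-odious i) ⟩
  ((1 ∸ thueMorse i) + ternary i * 3) % 3   ≡⟨ [m+kn]%n≡m%n (1 ∸ thueMorse i) (ternary i) 3 ⟩
  (1 ∸ thueMorse i) % 3                     ∎
  where open ≡-Reasoning
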